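{- Let $q\geq 2$ and let $C$ be a completely regular code in $H(3,q)$ with covering radius $1$ and eigenvalue $\lambda_2(3,q)$. Let $(x_1,x_2,u)\in C$. If there is $v\in\mathcal{A}$ such that $(\chi_C)_{3,u,v}$ is a string and $(\chi_C)_{3,u,v}(x_1,x_2)=1$, then $(x_1,x_2,u)$ is contained in a maximum clique of $H(3,q)$ all of whose vertices belong to $C$.
   Context: Let $\mathcal{A}$ be a set of size $q$; $H(3,q)$ has vertex set $\mathcal{A}^3$, tuples adjacent iff they differ in exactly one position; $\lambda_2(3,q)=q-3$. A set $C$ of vertices is a completely regular code with covering radius $1$ if $C$ is a nonempty proper subset and there are integers $\beta,\gamma\geq1$ such that every vertex of $C$ has exactly $\beta$ neighbours outside $C$ and every vertex outside $C$ has exactly $\gamma$ neighbours in $C$; it has eigenvalue $\lambda_2(3,q)$ iff $\beta+\gamma=2q$. A maximum clique is a set of $q$ tuples agreeing in all positions except one position $i$ and taking all $q$ symbols in position $i$. $\chi_C$ is the characteristic function of $C$, and for $u,v\in\mathcal{A}$, $(\chi_C)_{3,u,v}:\mathcal{A}^2\to\{ -1,0,1\}$ is defined by $(\chi_C)_{3,u,v}(y_1,y_2)=\chi_C(y_1,y_2,u)-\chi_C(y_1,y_2,v)$. A function $f:\mathcal{A}^2\to\mathbb{Z}$ is a string if there are disjoint nonempty $X,Y\subseteq\mathcal{A}$ with $|X|=|Y|$ and $j\in\{1,2\}$ such that $f(y)=1$ if $y_j\in X$, $f(y)=-1$ if $y_j\in Y$, and $f(y)=0$ otherwise. -}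

module Defs where

open import Data.Nat using (ℕ; zero; suc; _+_; _≥_)
open import Data.Integer using (ℤ; +_; -[1+_]; _-_)
open import Data.Fin using (Fin; zero; suc)
open import Data.Fin.Subset using (Subset; _∈_; _∉_; Nonempty; Empty; _∩_; ∣_∣)
open import Data.Bool using (Bool; true; false; if_then_else_)
open import Data.Product using (_×_; _,_; ∃; ∃-syntax; Σ)
open import Data.List using (List; length; filter; cartesianProduct; map)
open import Data.Fin.Properties using () renaming (_≟_ to _≟ᶠ_)
open import Data.Vec.Functional using (Vector)
open import Relation.Binary.PropositionalEquality using (_≡_; _≢_)
open import Relation.Nullary using (¬_; Dec; yes; no)
open import Relation.Nullary.Decidable using (⌊_⌋)
import Data.List as L

-- The alphabet 𝒜 is Fin q (a set of size q).
-- Vertices of H(3,q): triples of symbols (x₁, x₂, x₃).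
Vertex : ℕ → Set
Vertex q = Fin q × Fin q × Fin q

-- coordinate access, positions indexed by Fin 3 (zero = position 1, etc.)
coord : ∀ {q} → Vertex q → Fin 3 → Fin q
coord (a , b , c) zero = a
coord (a , b , c) (suc zero) = b
coord (a , b , c) (suc (suc zero)) = c

diff : ∀ {q} → Fin q → Fin q → ℕ
diff a b with a ≟ᶠ b
... | yes _ = 0
... | no _ = 1

dist : ∀ {q} → Vertex q → Vertex q → ℕ
dist (a₁ , a₂ , a₃) (b₁ , b₂ , b₃) = diff a₁ b₁ + diff a₂ b₂ + diff a₃ b₃

Adjacent : ∀ {q} → Vertex q → Vertex q → Set
Adjacent x y = dist x y ≡ 1

allVertices : (q : ℕ) → List (Vertex q)
allVertices q = cartesianProduct (L.allFin q) (cartesianProduct (L.allFin q) (L.allFin q))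

Code : ℕ → Set
Code q = Vertex q → Bool

_∈C_ : ∀ {q} → Vertex q → Code q → Set
x ∈C C = C x ≡ true

nbrsIn : ∀ {q} → Code q → Vertex q → ℕ
nbrsIn {q} C x = length (filter (λ y → (dist x y Data.Nat.≟ 1) Relation.Nullary.×-dec (C y Data.Bool.≟ true)) (allVertices q))
  where import Data.Nat ; import Data.Bool ; import Relation.Nullary

nbrsOut : ∀ {q} → Code q → Vertex q → ℕ
nbrsOut {q} C x = length (filter (λ y → (dist x y Data.Nat.≟ 1) Relation.Nullary.×-dec (C y Data.Bool.≟ false)) (allVertices q))
  where import Data.Nat ; import Data.Bool ; import Relation.Nullary

IsCRC1 : ∀ {q} → Code q → ℕ → ℕ → Set
IsCRC1 {q} C β γ =
  (∃[ x ] x ∈C C) × (∃[ x ] C x ≡ false) × β ≥ 1 × γ ≥ 1 ×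
  (∀ x → x ∈C C → nbrsOut C x ≡ β) ×
  (∀ x → C x ≡ false → nbrsIn C x ≡ γ)

-- completely regular code with covering radius 1 and eigenvalue λ₂(3,q) = q - 3
-- (equivalently β + γ = 2q, as given in the context)
IsCRC1λ₂ : ∀ {q} → Code q → Set
IsCRC1λ₂ {q} C = ∃[ β ] ∃[ γ ] (IsCRC1 C β γ × β + γ ≡ 2 Data.Nat.* q)
  where import Data.Nat

χ : ∀ {q} → Code q → Vertex q → ℤ
χ C x = if C x then + 1 else + 0

χ3 : ∀ {q} → Code q → Fin q → Fin q → Fin q × Fin q → ℤ
χ3 C u v (y₁ , y₂) = χ C (y₁ , y₂ , u) - χ C (y₁ , y₂ , v)

coord2 : ∀ {q} → Fin q × Fin q → Fin 2 → Fin q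
coord2 (a , b) zero = a
coord2 (a , b) (suc zero) = b

IsString : ∀ {q} → (Fin q × Fin q → ℤ) → Set
IsString {q} f =
  Σ (Subset q) λ X → Σ (Subset q) λ Y → Σ (Fin 2) λ j →
    (Nonempty X × Nonempty Y × Empty (X ∩ Y) × ∣ X ∣ ≡ ∣ Y ∣ ×
     (∀ (y : Fin q × Fin q) →
        (coord2 y j ∈ X → f y ≡ + 1) ×
        (coord2 y j ∈ Y → f y ≡ -[1+ 0 ]) ×
        (coord2 y j ∉ X → coord2 y j ∉ Y → f y ≡ + 0)))

-- maximum clique of H(3,q): determined by a position i and a base vertex b;
-- it is the set of the q tuples agreeing with b in all positions except i.
InClique : ∀ {q} → Fin 3 → Vertex q → Vertex q → Set
InClique i b w = ∀ (k : Fin 3) → k ≢ i → coord w k ≡ coord b k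

InMaxCliqueOfC : ∀ {q} → Code q → Vertex q → Set
InMaxCliqueOfC {q} C x =
  Σ (Fin 3) λ i → Σ (Vertex q) λ b →
    InClique i b x × (∀ w → InClique i b w → w ∈C C)

-- A string equals 1 on a whole line {y | y_j = x_j} of 𝒜², and
-- (χ_C)_{3,u,v}(y) = 1 forces (y, u) ∈ C. Hence the line through (x₁, x₂) in
-- direction j lifts to a maximum clique of the layer y₃ = u lying inside C.
module Submission where

open import Defs
open import Data.Nat using (ℕ; _≥_)
open import Data.Fin using (Fin; zero; suc)
open import Data.Fin.Subset using (_∈_)
open import Data.Fin.Subset.Properties using (_∈?_)
open import Data.Integer using (ℤ; +_; _-_)
open import Data.Bool using (true; false)
open import Data.Product using (_,_; ∃-syntax; _×_; proj₁; proj₂)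
open import Relation.Binary.PropositionalEquality using (_≡_; refl; sym; trans; subst)
open import Relation.Nullary using (yes; no)

χ-difference≡1⇒∈C : ∀ {q} (C : Code q) (x y : Vertex q) → χ C x - χ C y ≡ + 1 → x ∈C C
χ-difference≡1⇒∈C C x y eq with C x | C y
... | true  | _     = refl
... | false | true  with () ← eq
... | false | false with () ← eq

string-level1-line : ∀ {q} {f : Fin q × Fin q → ℤ} → IsString f →
  ∀ y → f y ≡ + 1 → ∃[ j ] (∀ z → coord2 z j ≡ coord2 y j → f z ≡ + 1)
string-level1-line {f = f} (X , Y , j , _ , _ , _ , _ , values) y fy≡1 =
  j , λ z zj≡yj → proj₁ (values z) (subst (_∈ X) (sym zj≡yj) yj∈X)
  where
  yj∈X : coord2 y j ∈ X
  yj∈X with coord2 y j ∈? X | coord2 y j ∈? Y | values y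
  ... | yes ∈X | _      | _                  = ∈X
  ... | no  _  | yes ∈Y | _ , on-Y , _       with () ← trans (sym fy≡1) (on-Y ∈Y)
  ... | no ∉X  | no ∉Y  | _ , _ , elsewhere  with () ← trans (sym fy≡1) (elsewhere ∉X ∉Y)

line-in-layer⇒InMaxCliqueOfC : ∀ {q} (C : Code q) (x₁ x₂ u : Fin q) (j : Fin 2) →
  (∀ z → coord2 z j ≡ coord2 (x₁ , x₂) j → (proj₁ z , proj₂ z , u) ∈C C) →
  InMaxCliqueOfC C (x₁ , x₂ , u)
line-in-layer⇒InMaxCliqueOfC C x₁ x₂ u zero line =
  suc zero , (x₁ , x₂ , u) , (λ _ _ → refl) , inside
  where
  inside : ∀ w → InClique (suc zero) (x₁ , x₂ , u) w → w ∈C C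
  inside (w₁ , w₂ , w₃) agrees with agrees zero (λ ()) | agrees (suc (suc zero)) (λ ())
  ... | refl | refl = line (x₁ , w₂) refl
line-in-layer⇒InMaxCliqueOfC C x₁ x₂ u (suc zero) line =
  zero , (x₁ , x₂ , u) , (λ _ _ → refl) , inside
  where
  inside : ∀ w → InClique zero (x₁ , x₂ , u) w → w ∈C C
  inside (w₁ , w₂ , w₃) agrees with agrees (suc zero) (λ ()) | agrees (suc (suc zero)) (λ ())
  ... | refl | refl = line (w₁ , x₂) refl

lemma6 : (q : ℕ) → q ≥ 2 → (C : Code q) → IsCRC1λ₂ C →
    (x₁ x₂ u : Fin q) → (x₁ , x₂ , u) ∈C C →
    (∃[ v ] (IsString (χ3 C u v) × χ3 C u v (x₁ , x₂) ≡ + 1)) →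
    InMaxCliqueOfC C (x₁ , x₂ , u)
lemma6 q _ C _ x₁ x₂ u _ (v , string , χ3≡1)
  with string-level1-line string (x₁ , x₂) χ3≡1
... | j , on-line =
  line-in-layer⇒InMaxCliqueOfC C x₁ x₂ u j λ (z₁ , z₂) zj≡xj →
    χ-difference≡1⇒∈C C (z₁ , z₂ , u) (z₁ , z₂ , v) (on-line (z₁ , z₂) zj≡xj)
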